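{- For all $n\geq 1$, $$(-1)^{n-1}p_n(x)=(1+x)^{n-1}R_n\!\left(\frac{1}{1+x}\right).$$
   Context: The Ramanujan polynomials $R_n(y)$ are defined by $R_1(y)=1$ and $R_{n+1}(y)=n(1+y)R_n(y)+y^2R_n'(y)$ for $n\geq1$. The polynomials $p_n(x)$ are defined by $p_1(x)=1$ and $p_{n+1}(x)=-(nx+3n-1)p_n(x)+(1+x)p_n'(x)$ for $n\geq1$. -}

module Defs where

open import Data.Nat using (ℕ; zero; suc)
import Data.Nat as ℕ
open import Data.Integer as ℤ using (ℤ; +_)
open import Data.List using (List; []; _∷_)
open import Data.Rational using (ℚ; 0ℚ; 1ℚ; _/_) renaming (_+_ to _+ℚ_; _*_ to _*ℚ_)

-- Polynomials with integer coefficients, as coefficient lists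
-- (constant term first).
Poly : Set
Poly = List ℤ

infixl 6 _⊕_
infixr 7 _·_

_⊕_ : Poly → Poly → Poly
[] ⊕ q = q
(a ∷ p) ⊕ [] = a ∷ p
(a ∷ p) ⊕ (b ∷ q) = (a ℤ.+ b) ∷ (p ⊕ q)

_·_ : ℤ → Poly → Poly
c · [] = []
c · (a ∷ p) = (c ℤ.* a) ∷ (c · p)

X* : Poly → Poly
X* p = + 0 ∷ p

deriv-from : ℕ → Poly → Poly
deriv-from k [] = []
deriv-from k (a ∷ p) = (+ k ℤ.* a) ∷ deriv-from (suc k) p

deriv : Poly → Poly
deriv [] = []
deriv (a ∷ p) = deriv-from 1 p

-- Ramanujan polynomials: R 1 = 1,
-- R (n+1) = n(1+y) R n + y² R n'.   (R 0 is an unused dummy.)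
R : ℕ → Poly
R zero = []
R (suc zero) = + 1 ∷ []
R (suc (suc n)) =
  ((+ suc n) · (R (suc n) ⊕ X* (R (suc n)))) ⊕ X* (X* (deriv (R (suc n))))

-- p 1 = 1,
-- p (n+1) = -(n x + 3n - 1) p n + (1+x) p n'.   (p 0 is an unused dummy.)
p : ℕ → Poly
p zero = []
p (suc zero) = + 1 ∷ []
p (suc (suc n)) =
  ((ℤ.- (+ (3 ℕ.* suc n ℕ.∸ 1))) · p (suc n))
    ⊕ ((ℤ.- (+ suc n)) · X* (p (suc n)))
    ⊕ (deriv (p (suc n)) ⊕ X* (deriv (p (suc n))))

eval : Poly → ℚ → ℚ
eval [] x = 0ℚ
eval (a ∷ q) x = (a / 1) +ℚ (x *ℚ eval q x)

_^ℚ_ : ℚ → ℕ → ℚ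
x ^ℚ zero = 1ℚ
x ^ℚ suc n = x *ℚ (x ^ℚ n)

-- For deg P ≤ m let recip m P = (1+X)^m P(1/(1+X)) = Σ aᵢ (1+X)^(m-i). This is linear,
-- recip m (X P) = recip (m-1) P, recip (m+1) P = (1+X) recip m P, and differentiating
-- termwise gives (1+X) (recip m P)' = m recip m P - recip (m-1) P'. Applying recip n to
-- R_{n+1} = n(1+y)R_n + y²R_n' therefore shows that G_n = recip (n-1) R_n satisfies
-- G_{n+1} = (nx + 3n - 1) G_n - (1+x) G_n', which is the recurrence satisfied by
-- (-1)^(n-1) p_n. Hence the two polynomials agree, and evaluating at x gives the theorem.

module Submission where

open import Defs
open import Data.Nat as ℕ using (ℕ; zero; suc; _≥_; _∸_; _≤_; z≤n; s≤s)
open import Data.List using ([]; _∷_)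
import Data.Nat.Properties as ℕP
open import Relation.Binary.PropositionalEquality
open import Level using (0ℓ)
open import Relation.Binary.Bundles using (Setoid)
open import Relation.Binary.Structures using (IsEquivalence)
import Relation.Binary.Reasoning.Setoid as SetoidReasoning

module IntegerPolynomials where

  open import Data.Integer using (ℤ; +_; -1ℤ; _+_; _*_; -_; _-_)
  import Data.Integer.Properties as ℤP
  open import Data.Integer.Tactic.RingSolver using (solve-∀)

  coeff : Poly → ℕ → ℤ
  coeff []      k       = + 0
  coeff (a ∷ P) zero    = a
  coeff (a ∷ P) (suc k) = coeff P k

  -- Lists with trailing zeros represent the same polynomial, so equality is coefficientwise.
  infix 4 _≈_
  record _≈_ (P Q : Poly) : Set where
    constructor coeffwise
    field coeff-≡ : ∀ k → coeff P k ≡ coeff Q k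
  open _≈_ public

  ≈-isEquivalence : IsEquivalence _≈_
  ≈-isEquivalence = record
    { refl  = coeffwise λ k → refl
    ; sym   = λ P≈Q → coeffwise λ k → sym (coeff-≡ P≈Q k)
    ; trans = λ P≈Q Q≈U → coeffwise λ k → trans (coeff-≡ P≈Q k) (coeff-≡ Q≈U k)
    }

  ≈-setoid : Setoid 0ℓ 0ℓ
  ≈-setoid = record { isEquivalence = ≈-isEquivalence }

  open IsEquivalence ≈-isEquivalence public
    using () renaming (refl to ≈-refl; sym to ≈-sym; trans to ≈-trans)

  module ≈-Reasoning = SetoidReasoning ≈-setoid

  ∷-≈[] : ∀ {a P} → a ∷ P ≈ [] → P ≈ []
  ∷-≈[] a∷P≈[] = coeffwise λ k → coeff-≡ a∷P≈[] (suc k)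

  ∷-cancel-≈ : ∀ {a b P Q} → a ∷ P ≈ b ∷ Q → P ≈ Q
  ∷-cancel-≈ a∷P≈b∷Q = coeffwise λ k → coeff-≡ a∷P≈b∷Q (suc k)

  coeff-⊕ : ∀ P Q k → coeff (P ⊕ Q) k ≡ coeff P k + coeff Q k
  coeff-⊕ []      Q       k       = sym (ℤP.+-identityˡ (coeff Q k))
  coeff-⊕ (a ∷ P) []      k       = sym (ℤP.+-identityʳ (coeff (a ∷ P) k))
  coeff-⊕ (a ∷ P) (b ∷ Q) zero    = refl
  coeff-⊕ (a ∷ P) (b ∷ Q) (suc k) = coeff-⊕ P Q k

  coeff-· : ∀ c P k → coeff (c · P) k ≡ c * coeff P k
  coeff-· c []      k       = sym (ℤP.*-zeroʳ c)
  coeff-· c (a ∷ P) zero    = refl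
  coeff-· c (a ∷ P) (suc k) = coeff-· c P k

  coeff-deriv-from : ∀ j P k → coeff (deriv-from j P) k ≡ + (j ℕ.+ k) * coeff P k
  coeff-deriv-from j []      k       = sym (ℤP.*-zeroʳ (+ (j ℕ.+ k)))
  coeff-deriv-from j (a ∷ P) zero    = cong (λ i → + i * a) (sym (ℕP.+-identityʳ j))
  coeff-deriv-from j (a ∷ P) (suc k) = trans (coeff-deriv-from (suc j) P k)
    (cong (λ i → + i * coeff P k) (sym (ℕP.+-suc j k)))

  coeff-deriv : ∀ P k → coeff (deriv P) k ≡ + suc k * coeff P (suc k)
  coeff-deriv []      k = sym (ℤP.*-zeroʳ (+ suc k))
  coeff-deriv (a ∷ P) k = coeff-deriv-from 1 P k

  ⊕-cong : ∀ {P P′ Q Q′} → P ≈ P′ → Q ≈ Q′ → P ⊕ Q ≈ P′ ⊕ Q′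
  ⊕-cong {P} {P′} {Q} {Q′} P≈P′ Q≈Q′ = coeffwise λ k → begin
    coeff (P ⊕ Q) k             ≡⟨ coeff-⊕ P Q k ⟩
    coeff P k + coeff Q k       ≡⟨ cong₂ _+_ (coeff-≡ P≈P′ k) (coeff-≡ Q≈Q′ k) ⟩
    coeff P′ k + coeff Q′ k     ≡⟨ coeff-⊕ P′ Q′ k ⟨
    coeff (P′ ⊕ Q′) k           ∎
    where open ≡-Reasoning

  ⊕-congˡ : ∀ P {Q Q′} → Q ≈ Q′ → P ⊕ Q ≈ P ⊕ Q′
  ⊕-congˡ P = ⊕-cong ≈-refl

  ⊕-congʳ : ∀ {P P′} Q → P ≈ P′ → P ⊕ Q ≈ P′ ⊕ Q
  ⊕-congʳ Q P≈P′ = ⊕-cong P≈P′ ≈-refl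

  ·-cong : ∀ c {P P′} → P ≈ P′ → c · P ≈ c · P′
  ·-cong c {P} {P′} P≈P′ = coeffwise λ k → begin
    coeff (c · P) k     ≡⟨ coeff-· c P k ⟩
    c * coeff P k       ≡⟨ cong (c *_) (coeff-≡ P≈P′ k) ⟩
    c * coeff P′ k      ≡⟨ coeff-· c P′ k ⟨
    coeff (c · P′) k    ∎
    where open ≡-Reasoning

  X*-cong : ∀ {P P′} → P ≈ P′ → X* P ≈ X* P′
  X*-cong P≈P′ = coeffwise λ { zero → refl ; (suc k) → coeff-≡ P≈P′ k }

  deriv-cong : ∀ {P P′} → P ≈ P′ → deriv P ≈ deriv P′
  deriv-cong {P} {P′} P≈P′ = coeffwise λ k → begin
    coeff (deriv P) k               ≡⟨ coeff-deriv P k ⟩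
    + suc k * coeff P (suc k)       ≡⟨ cong (+ suc k *_) (coeff-≡ P≈P′ (suc k)) ⟩
    + suc k * coeff P′ (suc k)      ≡⟨ coeff-deriv P′ k ⟨
    coeff (deriv P′) k              ∎
    where open ≡-Reasoning

  1+X* : Poly → Poly
  1+X* P = P ⊕ X* P

  1+X*-cong : ∀ {P P′} → P ≈ P′ → 1+X* P ≈ 1+X* P′
  1+X*-cong P≈P′ = ⊕-cong P≈P′ (X*-cong P≈P′)

  ⊕-identityʳ : ∀ P → P ⊕ [] ≈ P
  ⊕-identityʳ P = coeffwise λ k → trans (coeff-⊕ P [] k) (ℤP.+-identityʳ (coeff P k))

  ⊕-interchange : ∀ P Q U V → (P ⊕ Q) ⊕ (U ⊕ V) ≈ (P ⊕ U) ⊕ (Q ⊕ V)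
  ⊕-interchange P Q U V = coeffwise λ k → begin
    coeff ((P ⊕ Q) ⊕ (U ⊕ V)) k
      ≡⟨ trans (coeff-⊕ (P ⊕ Q) (U ⊕ V) k) (cong₂ _+_ (coeff-⊕ P Q k) (coeff-⊕ U V k)) ⟩
    (coeff P k + coeff Q k) + (coeff U k + coeff V k)
      ≡⟨ interchange (coeff P k) (coeff Q k) (coeff U k) (coeff V k) ⟩
    (coeff P k + coeff U k) + (coeff Q k + coeff V k)
      ≡⟨ trans (coeff-⊕ (P ⊕ U) (Q ⊕ V) k) (cong₂ _+_ (coeff-⊕ P U k) (coeff-⊕ Q V k)) ⟨
    coeff ((P ⊕ U) ⊕ (Q ⊕ V)) k ∎
    where
    open ≡-Reasoning
    interchange : ∀ a b c d → (a + b) + (c + d) ≡ (a + c) + (b + d)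
    interchange = solve-∀

  ·-zeroˡ : ∀ P → + 0 · P ≈ []
  ·-zeroˡ P = coeffwise λ k → coeff-· (+ 0) P k

  ·-identityˡ : ∀ P → + 1 · P ≈ P
  ·-identityˡ P = coeffwise λ k → trans (coeff-· (+ 1) P k) (ℤP.*-identityˡ (coeff P k))

  ·-assoc : ∀ a b P → (a * b) · P ≈ a · (b · P)
  ·-assoc a b P = coeffwise λ k → begin
    coeff ((a * b) · P) k     ≡⟨ coeff-· (a * b) P k ⟩
    (a * b) * coeff P k       ≡⟨ ℤP.*-assoc a b (coeff P k) ⟩
    a * (b * coeff P k)       ≡⟨ trans (coeff-· a (b · P) k) (cong (a *_) (coeff-· b P k)) ⟨
    coeff (a · (b · P)) k     ∎
    where open ≡-Reasoning

  ·-swap : ∀ a b P → a · (b · P) ≈ b · (a · P)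
  ·-swap a b P = begin
    a · (b · P)   ≈⟨ ·-assoc a b P ⟨
    (a * b) · P   ≡⟨ cong (_· P) (ℤP.*-comm a b) ⟩
    (b * a) · P   ≈⟨ ·-assoc b a P ⟩
    b · (a · P)   ∎
    where open ≈-Reasoning

  ·-distribˡ-⊕ : ∀ c P Q → c · (P ⊕ Q) ≈ c · P ⊕ c · Q
  ·-distribˡ-⊕ c P Q = coeffwise λ k → begin
    coeff (c · (P ⊕ Q)) k               ≡⟨ trans (coeff-· c (P ⊕ Q) k) (cong (c *_) (coeff-⊕ P Q k)) ⟩
    c * (coeff P k + coeff Q k)         ≡⟨ ℤP.*-distribˡ-+ c (coeff P k) (coeff Q k) ⟩
    c * coeff P k + c * coeff Q k       ≡⟨ trans (coeff-⊕ (c · P) (c · Q) k) (cong₂ _+_ (coeff-· c P k) (coeff-· c Q k)) ⟨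
    coeff (c · P ⊕ c · Q) k             ∎
    where open ≡-Reasoning

  ·-distribʳ-+ : ∀ a b P → (a + b) · P ≈ a · P ⊕ b · P
  ·-distribʳ-+ a b P = coeffwise λ k → begin
    coeff ((a + b) · P) k               ≡⟨ coeff-· (a + b) P k ⟩
    (a + b) * coeff P k                 ≡⟨ ℤP.*-distribʳ-+ (coeff P k) a b ⟩
    a * coeff P k + b * coeff P k       ≡⟨ trans (coeff-⊕ (a · P) (b · P) k) (cong₂ _+_ (coeff-· a P k) (coeff-· b P k)) ⟨
    coeff (a · P ⊕ b · P) k             ∎
    where open ≡-Reasoning

  X*-· : ∀ c P → X* (c · P) ≈ c · X* P
  X*-· c P = coeffwise λ { zero → sym (ℤP.*-zeroʳ c) ; (suc k) → refl }

  1+X*-[] : 1+X* [] ≈ []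
  1+X*-[] = coeffwise λ { zero → refl ; (suc k) → refl }

  1+X*-⊕ : ∀ P Q → 1+X* (P ⊕ Q) ≈ 1+X* P ⊕ 1+X* Q
  1+X*-⊕ P Q = ⊕-interchange P Q (X* P) (X* Q)

  1+X*-· : ∀ c P → 1+X* (c · P) ≈ c · 1+X* P
  1+X*-· c P = begin
    c · P ⊕ X* (c · P)   ≈⟨ ⊕-congˡ (c · P) (X*-· c P) ⟩
    c · P ⊕ c · X* P     ≈⟨ ·-distribˡ-⊕ c P (X* P) ⟨
    c · (P ⊕ X* P)       ∎
    where open ≈-Reasoning

  deriv-⊕ : ∀ P Q → deriv (P ⊕ Q) ≈ deriv P ⊕ deriv Q
  deriv-⊕ P Q = coeffwise λ k → begin
    coeff (deriv (P ⊕ Q)) k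
      ≡⟨ trans (coeff-deriv (P ⊕ Q) k) (cong (+ suc k *_) (coeff-⊕ P Q (suc k))) ⟩
    + suc k * (coeff P (suc k) + coeff Q (suc k))
      ≡⟨ ℤP.*-distribˡ-+ (+ suc k) (coeff P (suc k)) (coeff Q (suc k)) ⟩
    + suc k * coeff P (suc k) + + suc k * coeff Q (suc k)
      ≡⟨ trans (coeff-⊕ (deriv P) (deriv Q) k) (cong₂ _+_ (coeff-deriv P k) (coeff-deriv Q k)) ⟨
    coeff (deriv P ⊕ deriv Q) k ∎
    where open ≡-Reasoning

  deriv-· : ∀ c P → deriv (c · P) ≈ c · deriv P
  deriv-· c P = coeffwise λ k → begin
    coeff (deriv (c · P)) k
      ≡⟨ trans (coeff-deriv (c · P) k) (cong (+ suc k *_) (coeff-· c P (suc k))) ⟩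
    + suc k * (c * coeff P (suc k))
      ≡⟨ swap (+ suc k) c (coeff P (suc k)) ⟩
    c * (+ suc k * coeff P (suc k))
      ≡⟨ trans (coeff-· c (deriv P) k) (cong (c *_) (coeff-deriv P k)) ⟨
    coeff (c · deriv P) k ∎
    where
    open ≡-Reasoning
    swap : ∀ a b d → a * (b * d) ≡ b * (a * d)
    swap = solve-∀

  deriv-1+X* : ∀ P → deriv (1+X* P) ≈ P ⊕ 1+X* (deriv P)
  deriv-1+X* P = coeffwise λ k → begin
    coeff (deriv (1+X* P)) k
      ≡⟨ trans (coeff-deriv (1+X* P) k) (cong (+ suc k *_) (coeff-⊕ P (X* P) (suc k))) ⟩
    + suc k * (coeff P (suc k) + coeff P k)
      ≡⟨ leibniz k ⟩
    coeff P k + (+ suc k * coeff P (suc k) + coeff (X* (deriv P)) k)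
      ≡⟨ trans (coeff-⊕ P (1+X* (deriv P)) k)
           (cong (λ d → coeff P k + d) (trans (coeff-⊕ (deriv P) (X* (deriv P)) k)
             (cong (_+ coeff (X* (deriv P)) k) (coeff-deriv P k)))) ⟨
    coeff (P ⊕ 1+X* (deriv P)) k ∎
    where
    open ≡-Reasoning
    leibniz : ∀ k → + suc k * (coeff P (suc k) + coeff P k)
                  ≡ coeff P k + (+ suc k * coeff P (suc k) + coeff (X* (deriv P)) k)
    leibniz zero    = lemma (coeff P 1) (coeff P 0)
      where
      lemma : ∀ a b → + 1 * (a + b) ≡ b + (+ 1 * a + + 0)
      lemma = solve-∀
    leibniz (suc k) = trans (lemma (+ suc k) (coeff P (2 ℕ.+ k)) (coeff P (suc k)))
      (cong (λ d → coeff P (suc k) + (+ suc (suc k) * coeff P (2 ℕ.+ k) + d)) (sym (coeff-deriv P k)))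
      where
      lemma : ∀ j a b → (+ 1 + j) * (a + b) ≡ b + ((+ 1 + j) * a + j * b)
      lemma = solve-∀

  1+X^_ : ℕ → Poly
  1+X^ zero  = + 1 ∷ []
  1+X^ suc m = 1+X* (1+X^ m)

  1+X*-deriv-1+X^ : ∀ m → 1+X* (deriv (1+X^ m)) ≈ + m · 1+X^ m
  1+X*-deriv-1+X^ zero    = ≈-refl
  1+X*-deriv-1+X^ (suc m) = begin
    1+X* (deriv (1+X* U))             ≈⟨ 1+X*-cong (deriv-1+X* U) ⟩
    1+X* (U ⊕ 1+X* (deriv U))         ≈⟨ 1+X*-cong (⊕-cong (≈-sym (·-identityˡ U)) (1+X*-deriv-1+X^ m)) ⟩
    1+X* (+ 1 · U ⊕ + m · U)          ≈⟨ 1+X*-cong (·-distribʳ-+ (+ 1) (+ m) U) ⟨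
    1+X* (+ suc m · U)                ≈⟨ 1+X*-· (+ suc m) U ⟩
    + suc m · 1+X* U                  ∎
    where
    open ≈-Reasoning
    U = 1+X^ m

  -- recip m P = (1+X)^m P(1/(1+X)) provided deg P ≤ m; beyond that the truncated m ∸ 1
  -- produces junk, whence the DegreeBelow hypotheses below.
  recip : ℕ → Poly → Poly
  recip m []      = []
  recip m (a ∷ P) = a · 1+X^ m ⊕ recip (m ∸ 1) P

  recip-zero : ∀ m {P} → P ≈ [] → recip m P ≈ []
  recip-zero m {[]}    _       = ≈-refl
  recip-zero m {a ∷ P} a∷P≈[] rewrite coeff-≡ a∷P≈[] 0 =
    ⊕-cong (·-zeroˡ (1+X^ m)) (recip-zero (m ∸ 1) (∷-≈[] a∷P≈[]))

  recip-⊕ : ∀ m P Q → recip m (P ⊕ Q) ≈ recip m P ⊕ recip m Q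
  recip-⊕ m []      Q       = ≈-refl
  recip-⊕ m (a ∷ P) []      = ≈-sym (⊕-identityʳ (recip m (a ∷ P)))
  recip-⊕ m (a ∷ P) (b ∷ Q) = begin
    (a + b) · U ⊕ recip (m ∸ 1) (P ⊕ Q)
      ≈⟨ ⊕-cong (·-distribʳ-+ a b U) (recip-⊕ (m ∸ 1) P Q) ⟩
    (a · U ⊕ b · U) ⊕ (recip (m ∸ 1) P ⊕ recip (m ∸ 1) Q)
      ≈⟨ ⊕-interchange (a · U) (b · U) (recip (m ∸ 1) P) (recip (m ∸ 1) Q) ⟩
    (a · U ⊕ recip (m ∸ 1) P) ⊕ (b · U ⊕ recip (m ∸ 1) Q) ∎
    where
    open ≈-Reasoning
    U = 1+X^ m

  recip-· : ∀ m c P → recip m (c · P) ≈ c · recip m P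
  recip-· m c []      = ≈-refl
  recip-· m c (a ∷ P) = begin
    (c * a) · U ⊕ recip (m ∸ 1) (c · P)   ≈⟨ ⊕-cong (·-assoc c a U) (recip-· (m ∸ 1) c P) ⟩
    c · (a · U) ⊕ c · recip (m ∸ 1) P     ≈⟨ ·-distribˡ-⊕ c (a · U) (recip (m ∸ 1) P) ⟨
    c · (a · U ⊕ recip (m ∸ 1) P)         ∎
    where
    open ≈-Reasoning
    U = 1+X^ m

  recip-X* : ∀ m P → recip m (X* P) ≈ recip (m ∸ 1) P
  recip-X* m P = ⊕-congʳ (recip (m ∸ 1) P) (·-zeroˡ (1+X^ m))

  DegreeBelow : ℕ → Poly → Set
  DegreeBelow d P = ∀ k → d ≤ k → coeff P k ≡ + 0

  degreeBelow-zero : ∀ P → DegreeBelow 0 P → P ≈ []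
  degreeBelow-zero P deg = coeffwise λ k → deg k z≤n

  degreeBelow-tail : ∀ {d a P} → DegreeBelow (suc d) (a ∷ P) → DegreeBelow d P
  degreeBelow-tail deg k d≤k = deg (suc k) (s≤s d≤k)

  degreeBelow-suc : ∀ {d} P → DegreeBelow d P → DegreeBelow (suc d) P
  degreeBelow-suc P deg k d<k = deg k (ℕP.<⇒≤ d<k)

  degreeBelow-⊕ : ∀ {d} P Q → DegreeBelow d P → DegreeBelow d Q → DegreeBelow d (P ⊕ Q)
  degreeBelow-⊕ P Q degP degQ k d≤k =
    trans (coeff-⊕ P Q k) (cong₂ _+_ (degP k d≤k) (degQ k d≤k))

  degreeBelow-· : ∀ {d} c P → DegreeBelow d P → DegreeBelow d (c · P)
  degreeBelow-· c P deg k d≤k =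
    trans (coeff-· c P k) (trans (cong (c *_) (deg k d≤k)) (ℤP.*-zeroʳ c))

  degreeBelow-X* : ∀ {d} P → DegreeBelow d P → DegreeBelow (suc d) (X* P)
  degreeBelow-X* P deg (suc k) (s≤s d≤k) = deg k d≤k

  degreeBelow-deriv-from : ∀ {d} j P → DegreeBelow d P → DegreeBelow d (deriv-from j P)
  degreeBelow-deriv-from j P deg k d≤k = trans (coeff-deriv-from j P k)
    (trans (cong (+ (j ℕ.+ k) *_) (deg k d≤k)) (ℤP.*-zeroʳ (+ (j ℕ.+ k))))

  degreeBelow-deriv : ∀ {d} P → DegreeBelow (suc d) P → DegreeBelow d (deriv P)
  degreeBelow-deriv []      deg k _ = refl
  degreeBelow-deriv (a ∷ P) deg     = degreeBelow-deriv-from 1 P (degreeBelow-tail deg)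

  recip-suc : ∀ m P → DegreeBelow (suc m) P → recip (suc m) P ≈ 1+X* (recip m P)
  recip-suc m []      _   = ≈-sym 1+X*-[]
  recip-suc m (a ∷ P) deg = begin
    a · 1+X* (1+X^ m) ⊕ recip m P                   ≈⟨ ⊕-cong (≈-sym (1+X*-· a (1+X^ m))) (tail m (degreeBelow-tail deg)) ⟩
    1+X* (a · 1+X^ m) ⊕ 1+X* (recip (m ∸ 1) P)      ≈⟨ 1+X*-⊕ (a · 1+X^ m) (recip (m ∸ 1) P) ⟨
    1+X* (recip m (a ∷ P))                          ∎
    where
    open ≈-Reasoning
    tail : ∀ n → DegreeBelow n P → recip n P ≈ 1+X* (recip (n ∸ 1) P)
    tail zero    degP = begin
      recip 0 P          ≈⟨ recip-zero 0 (degreeBelow-zero P degP) ⟩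
      []                 ≈⟨ 1+X*-[] ⟨
      1+X* []            ≈⟨ 1+X*-cong (recip-zero 0 (degreeBelow-zero P degP)) ⟨
      1+X* (recip 0 P)   ∎
    tail (suc n) degP = recip-suc n P degP

  -- deriv-from j P has coefficients (j + i) aᵢ, and (1+X) (recip m P)' has terms
  -- (m - i) aᵢ (1+X)^(m-i); their sum is (j + m) recip m P termwise.
  recip-deriv-from : ∀ m j P → DegreeBelow (suc m) P →
    recip m (deriv-from j P) ⊕ 1+X* (deriv (recip m P)) ≈ + (j ℕ.+ m) · recip m P
  recip-deriv-from m j []      _   = 1+X*-[]
  recip-deriv-from m j (b ∷ P) deg = begin
    ((+ j * b) · U ⊕ D (m ∸ 1)) ⊕ 1+X* (deriv (b · U ⊕ recip (m ∸ 1) P))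
      ≈⟨ ⊕-congˡ ((+ j * b) · U ⊕ D (m ∸ 1)) derivative ⟩
    ((+ j * b) · U ⊕ D (m ∸ 1)) ⊕ (b · (+ m · U) ⊕ S (m ∸ 1))
      ≈⟨ ⊕-interchange ((+ j * b) · U) (D (m ∸ 1)) (b · (+ m · U)) (S (m ∸ 1)) ⟩
    ((+ j * b) · U ⊕ b · (+ m · U)) ⊕ (D (m ∸ 1) ⊕ S (m ∸ 1))
      ≈⟨ ⊕-cong head (tail m (degreeBelow-tail deg)) ⟩
    + (j ℕ.+ m) · (b · U) ⊕ + (j ℕ.+ m) · recip (m ∸ 1) P
      ≈⟨ ·-distribˡ-⊕ (+ (j ℕ.+ m)) (b · U) (recip (m ∸ 1) P) ⟨
    + (j ℕ.+ m) · (b · U ⊕ recip (m ∸ 1) P) ∎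
    where
    open ≈-Reasoning
    U = 1+X^ m
    D S : ℕ → Poly
    D n = recip n (deriv-from (suc j) P)
    S n = 1+X* (deriv (recip n P))

    derivative : 1+X* (deriv (b · U ⊕ recip (m ∸ 1) P)) ≈ b · (+ m · U) ⊕ S (m ∸ 1)
    derivative = begin
      1+X* (deriv (b · U ⊕ recip (m ∸ 1) P))    ≈⟨ 1+X*-cong (deriv-⊕ (b · U) (recip (m ∸ 1) P)) ⟩
      1+X* (deriv (b · U) ⊕ deriv (recip (m ∸ 1) P))
        ≈⟨ 1+X*-⊕ (deriv (b · U)) (deriv (recip (m ∸ 1) P)) ⟩
      1+X* (deriv (b · U)) ⊕ S (m ∸ 1)         ≈⟨ ⊕-congʳ (S (m ∸ 1)) (1+X*-cong (deriv-· b U)) ⟩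
      1+X* (b · deriv U) ⊕ S (m ∸ 1)           ≈⟨ ⊕-congʳ (S (m ∸ 1)) (1+X*-· b (deriv U)) ⟩
      b · 1+X* (deriv U) ⊕ S (m ∸ 1)           ≈⟨ ⊕-congʳ (S (m ∸ 1)) (·-cong b (1+X*-deriv-1+X^ m)) ⟩
      b · (+ m · U) ⊕ S (m ∸ 1)                ∎

    head : (+ j * b) · U ⊕ b · (+ m · U) ≈ + (j ℕ.+ m) · (b · U)
    head = begin
      (+ j * b) · U ⊕ b · (+ m · U)    ≈⟨ ⊕-cong (·-assoc (+ j) b U) (·-swap b (+ m) U) ⟩
      + j · (b · U) ⊕ + m · (b · U)    ≈⟨ ·-distribʳ-+ (+ j) (+ m) (b · U) ⟨
      + (j ℕ.+ m) · (b · U)            ∎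

    tail : ∀ n → DegreeBelow n P → D (n ∸ 1) ⊕ S (n ∸ 1) ≈ + (j ℕ.+ n) · recip (n ∸ 1) P
    tail zero    degP = begin
      D 0 ⊕ S 0                    ≈⟨ ⊕-cong D₀≈[] (≈-trans (1+X*-cong (deriv-cong P₀≈[])) 1+X*-[]) ⟩
      []                           ≈⟨ ·-cong (+ (j ℕ.+ 0)) P₀≈[] ⟨
      + (j ℕ.+ 0) · recip 0 P      ∎
      where
      P₀≈[] = recip-zero 0 (degreeBelow-zero P degP)
      D₀≈[] = recip-zero 0 (degreeBelow-zero (deriv-from (suc j) P) (degreeBelow-deriv-from (suc j) P degP))
    tail (suc n) degP = begin
      D n ⊕ S n                     ≈⟨ recip-deriv-from n (suc j) P degP ⟩
      + suc (j ℕ.+ n) · recip n P   ≡⟨ cong (λ i → + i · recip n P) (ℕP.+-suc j n) ⟨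
      + (j ℕ.+ suc n) · recip n P   ∎

  recip-deriv : ∀ m P → DegreeBelow (suc m) P →
    recip (m ∸ 1) (deriv P) ⊕ 1+X* (deriv (recip m P)) ≈ + m · recip m P
  recip-deriv m []      _   = 1+X*-[]
  recip-deriv m (a ∷ P) deg =
    ≈-trans (⊕-congʳ (1+X* (deriv (recip m (a ∷ P))))
                     (⊕-congʳ (recip (m ∸ 1) (deriv-from 1 P)) (≈-sym (·-zeroˡ (1+X^ m)))))
            (recip-deriv-from m 0 (a ∷ P) deg)

  degreeBelow-R : ∀ m → DegreeBelow (suc m) (R (suc m))
  degreeBelow-R zero    (suc k) _ = refl
  degreeBelow-R (suc m) =
    degreeBelow-⊕ (+ suc m · 1+X* R′) (X* (X* (deriv R′)))
      (degreeBelow-· (+ suc m) (1+X* R′) (degreeBelow-⊕ R′ (X* R′) (degreeBelow-suc R′ IH) (degreeBelow-X* R′ IH)))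
      (degreeBelow-X* (X* (deriv R′)) (degreeBelow-X* (deriv R′) (degreeBelow-deriv R′ IH)))
    where
    R′ = R (suc m)
    IH = degreeBelow-R m

  recip-R-suc : ∀ m → let R′ = R (suc m) in
    recip (suc m) (R (suc (suc m))) ≈ + suc m · (1+X* (recip m R′) ⊕ recip m R′) ⊕ recip (m ∸ 1) (deriv R′)
  recip-R-suc m = begin
    recip n (+ n · 1+X* R′ ⊕ X* (X* (deriv R′)))
      ≈⟨ recip-⊕ n (+ n · 1+X* R′) (X* (X* (deriv R′))) ⟩
    recip n (+ n · 1+X* R′) ⊕ recip n (X* (X* (deriv R′)))
      ≈⟨ ⊕-cong (recip-· n (+ n) (1+X* R′)) (≈-trans (recip-X* n (X* (deriv R′))) (recip-X* m (deriv R′))) ⟩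
    + n · recip n (R′ ⊕ X* R′) ⊕ recip (m ∸ 1) (deriv R′)
      ≈⟨ ⊕-congʳ (recip (m ∸ 1) (deriv R′)) (·-cong (+ n) (≈-trans (recip-⊕ n R′ (X* R′))
           (⊕-cong (recip-suc m R′ (degreeBelow-R m)) (recip-X* n R′)))) ⟩
    + n · (1+X* (recip m R′) ⊕ recip m R′) ⊕ recip (m ∸ 1) (deriv R′) ∎
    where
    open ≈-Reasoning
    n  = suc m
    R′ = R (suc m)

  -- p (suc (suc n)) unfolds definitionally to pNext (suc n) (p (suc n)).
  pNext : ℕ → Poly → Poly
  pNext n Q = (- + (3 ℕ.* n ∸ 1)) · Q ⊕ (- + n) · X* Q ⊕ 1+X* (deriv Q)

  pNext-cong : ∀ n {Q Q′} → Q ≈ Q′ → pNext n Q ≈ pNext n Q′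
  pNext-cong n Q≈Q′ =
    ⊕-cong (⊕-cong (·-cong _ Q≈Q′) (·-cong _ (X*-cong Q≈Q′))) (1+X*-cong (deriv-cong Q≈Q′))

  pNext-· : ∀ n c Q → pNext n (c · Q) ≈ c · pNext n Q
  pNext-· n c Q = begin
    A · (c · Q) ⊕ B · X* (c · Q) ⊕ 1+X* (deriv (c · Q))
      ≈⟨ ⊕-cong (⊕-cong (·-swap A c Q) (≈-trans (·-cong B (X*-· c Q)) (·-swap B c (X* Q))))
                (≈-trans (1+X*-cong (deriv-· c Q)) (1+X*-· c (deriv Q))) ⟩
    c · (A · Q) ⊕ c · (B · X* Q) ⊕ c · 1+X* (deriv Q)
      ≈⟨ ⊕-congʳ (c · 1+X* (deriv Q)) (·-distribˡ-⊕ c (A · Q) (B · X* Q)) ⟨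
    c · (A · Q ⊕ B · X* Q) ⊕ c · 1+X* (deriv Q)
      ≈⟨ ·-distribˡ-⊕ c (A · Q ⊕ B · X* Q) (1+X* (deriv Q)) ⟨
    c · pNext n Q ∎
    where
    open ≈-Reasoning
    A = - + (3 ℕ.* n ∸ 1)
    B = - + n

  recurrence-identity : ∀ m G E → E ⊕ 1+X* (deriv G) ≈ + m · G →
    + suc m · (1+X* G ⊕ G) ⊕ E ≈ -1ℤ · pNext (suc m) G
  recurrence-identity m G E E⊕V≈mG = coeffwise λ k →
    let g = coeff G k; x = coeff (X* G) k; v = coeff V k; e = coeff E k in begin
    coeff (+ suc m · (1+X* G ⊕ G) ⊕ E) k
      ≡⟨ trans (coeff-⊕ (+ suc m · (1+X* G ⊕ G)) E k) (cong (_+ e)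
           (trans (coeff-· (+ suc m) (1+X* G ⊕ G) k) (cong (+ suc m *_)
             (trans (coeff-⊕ (1+X* G) G k) (cong (_+ g) (coeff-⊕ G (X* G) k)))))) ⟩
    + suc m * ((g + x) + g) + e
      ≡⟨ cong (λ t → + suc m * ((g + x) + g) + t) (trans (add-sub e v)
           (cong (_- v) (trans (sym (coeff-⊕ E V k)) (trans (coeff-≡ E⊕V≈mG k) (coeff-· (+ m) G k))))) ⟩
    + suc m * ((g + x) + g) + (+ m * g - v)
      ≡⟨ identity (+ m) g x v ⟩
    -1ℤ * ((- + (3 ℕ.* suc m ∸ 1) * g + - + suc m * x) + v)
      ≡⟨ trans (coeff-· -1ℤ (pNext (suc m) G) k) (cong (-1ℤ *_)
           (trans (coeff-⊕ (A · G ⊕ B · X* G) V k) (cong (_+ v)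
             (trans (coeff-⊕ (A · G) (B · X* G) k) (cong₂ _+_ (coeff-· A G k) (coeff-· B (X* G) k)))))) ⟨
    coeff (-1ℤ · pNext (suc m) G) k ∎
    where
    open ≡-Reasoning
    V = 1+X* (deriv G)
    A = - + (3 ℕ.* suc m ∸ 1)
    B = - + suc m
    add-sub : ∀ a b → a ≡ (a + b) - b
    add-sub = solve-∀
    -- 3 * suc m ∸ 1 normalises to m + (suc m + (suc m + 0)), a form the ring solver can read.
    identity : ∀ M g x v → (+ 1 + M) * ((g + x) + g) + (M * g - v)
                         ≡ -1ℤ * ((- (M + ((+ 1 + M) + ((+ 1 + M) + + 0))) * g + - (+ 1 + M) * x) + v)
    identity = solve-∀

  sign : ℕ → ℤ
  sign zero    = + 1
  sign (suc m) = -1ℤ * sign m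

  sign-p≈recip-R : ∀ m → sign m · p (suc m) ≈ recip m (R (suc m))
  sign-p≈recip-R zero    = ≈-refl
  sign-p≈recip-R (suc m) = begin
    (-1ℤ * sign m) · pNext n P     ≈⟨ ·-assoc -1ℤ (sign m) (pNext n P) ⟩
    -1ℤ · (sign m · pNext n P)     ≈⟨ ·-cong -1ℤ (pNext-· n (sign m) P) ⟨
    -1ℤ · pNext n (sign m · P)     ≈⟨ ·-cong -1ℤ (pNext-cong n (sign-p≈recip-R m)) ⟩
    -1ℤ · pNext n G                ≈⟨ recurrence-identity m G E (recip-deriv m R′ (degreeBelow-R m)) ⟨
    + n · (1+X* G ⊕ G) ⊕ E         ≈⟨ recip-R-suc m ⟨
    recip n (R (suc n))            ∎
    where
    open ≈-Reasoning
    n  = suc m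
    P  = p n
    R′ = R n
    G  = recip m R′
    E  = recip (m ∸ 1) (deriv R′)

open IntegerPolynomials

open import Data.Integer as ℤ using (ℤ; +_)
open import Data.Rational using (ℚ; 0ℚ; 1ℚ; _+_; _*_; -_; 1/_; NonZero; fromℚᵘ)
import Data.Rational.Properties as ℚP
import Data.Rational.Unnormalised as ℚᵘ
import Data.Rational.Unnormalised.Properties as ℚᵘP
open import Data.Rational.Solver using (module +-*-Solver)
open +-*-Solver using (solve; con; _:+_; _:*_; _:=_)
open import Data.Integer.Tactic.RingSolver using (solve-∀)

fromℚᵘ-+ : ∀ p q → fromℚᵘ (p ℚᵘ.+ q) ≡ fromℚᵘ p + fromℚᵘ q
fromℚᵘ-+ p q = ℚP.toℚᵘ-injective
  (ℚᵘP.≃-trans (ℚP.toℚᵘ-fromℚᵘ (p ℚᵘ.+ q)) (ℚᵘP.≃-sym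
    (ℚᵘP.≃-trans (ℚP.toℚᵘ-homo-+ (fromℚᵘ p) (fromℚᵘ q))
                 (ℚᵘP.+-cong (ℚP.toℚᵘ-fromℚᵘ p) (ℚP.toℚᵘ-fromℚᵘ q)))))

fromℚᵘ-* : ∀ p q → fromℚᵘ (p ℚᵘ.* q) ≡ fromℚᵘ p * fromℚᵘ q
fromℚᵘ-* p q = ℚP.toℚᵘ-injective
  (ℚᵘP.≃-trans (ℚP.toℚᵘ-fromℚᵘ (p ℚᵘ.* q)) (ℚᵘP.≃-sym
    (ℚᵘP.≃-trans (ℚP.toℚᵘ-homo-* (fromℚᵘ p) (fromℚᵘ q))
                 (ℚᵘP.*-cong (ℚP.toℚᵘ-fromℚᵘ p) (ℚP.toℚᵘ-fromℚᵘ q)))))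

-- Definitionally i / 1, the embedding used by eval.
fromℤ : ℤ → ℚ
fromℤ i = fromℚᵘ (ℚᵘ.mkℚᵘ i 0)

fromℤ-+ : ∀ i j → fromℤ (i ℤ.+ j) ≡ fromℤ i + fromℤ j
fromℤ-+ i j = trans (ℚP.fromℚᵘ-cong {ℚᵘ.mkℚᵘ (i ℤ.+ j) 0} {ℚᵘ.mkℚᵘ i 0 ℚᵘ.+ ℚᵘ.mkℚᵘ j 0} (ℚᵘ.*≡* (identity i j)))
                    (fromℚᵘ-+ (ℚᵘ.mkℚᵘ i 0) (ℚᵘ.mkℚᵘ j 0))
  where
  identity : ∀ i j → (i ℤ.+ j) ℤ.* (+ 1 ℤ.* + 1) ≡ (i ℤ.* + 1 ℤ.+ j ℤ.* + 1) ℤ.* + 1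
  identity = solve-∀

fromℤ-* : ∀ i j → fromℤ (i ℤ.* j) ≡ fromℤ i * fromℤ j
fromℤ-* i j = trans (ℚP.fromℚᵘ-cong {ℚᵘ.mkℚᵘ (i ℤ.* j) 0} {ℚᵘ.mkℚᵘ i 0 ℚᵘ.* ℚᵘ.mkℚᵘ j 0} (ℚᵘ.*≡* (identity i j)))
                    (fromℚᵘ-* (ℚᵘ.mkℚᵘ i 0) (ℚᵘ.mkℚᵘ j 0))
  where
  identity : ∀ i j → (i ℤ.* j) ℤ.* (+ 1 ℤ.* + 1) ≡ (i ℤ.* j) ℤ.* + 1
  identity = solve-∀

fromℤ-sign : ∀ m → fromℤ (sign m) ≡ (- 1ℚ) ^ℚ m
fromℤ-sign zero    = refl
fromℤ-sign (suc m) = trans (fromℤ-* ℤ.-1ℤ (sign m)) (cong ((- 1ℚ) *_) (fromℤ-sign m))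

eval-⊕ : ∀ P Q x → eval (P ⊕ Q) x ≡ eval P x + eval Q x
eval-⊕ []      Q       x = sym (ℚP.+-identityˡ (eval Q x))
eval-⊕ (a ∷ P) []      x = sym (ℚP.+-identityʳ (eval (a ∷ P) x))
eval-⊕ (a ∷ P) (b ∷ Q) x = trans (cong₂ (λ c e → c + x * e) (fromℤ-+ a b) (eval-⊕ P Q x))
  (solve 5 (λ A B X E F → (A :+ B) :+ X :* (E :+ F) := (A :+ X :* E) :+ (B :+ X :* F))
     refl (fromℤ a) (fromℤ b) x (eval P x) (eval Q x))

eval-· : ∀ c P x → eval (c · P) x ≡ fromℤ c * eval P x
eval-· c []      x = sym (ℚP.*-zeroʳ (fromℤ c))
eval-· c (a ∷ P) x = trans (cong₂ (λ d e → d + x * e) (fromℤ-* c a) (eval-· c P x))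
  (solve 4 (λ C A X E → C :* A :+ X :* (C :* E) := C :* (A :+ X :* E))
     refl (fromℤ c) (fromℤ a) x (eval P x))

eval-zero : ∀ {P} x → P ≈ [] → eval P x ≡ 0ℚ
eval-zero {[]}    x _       = refl
eval-zero {a ∷ P} x a∷P≈[] rewrite coeff-≡ a∷P≈[] 0 =
  trans (cong (λ e → 0ℚ + x * e) (eval-zero x (∷-≈[] a∷P≈[])))
        (trans (ℚP.+-identityˡ (x * 0ℚ)) (ℚP.*-zeroʳ x))

eval-cong : ∀ {P Q} x → P ≈ Q → eval P x ≡ eval Q x
eval-cong {[]}    {Q}     x P≈Q = sym (eval-zero x (≈-sym P≈Q))
eval-cong {a ∷ P} {[]}    x P≈Q = eval-zero x P≈Q
eval-cong {a ∷ P} {b ∷ Q} x P≈Q =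
  cong₂ (λ c e → fromℤ c + x * e) (coeff-≡ P≈Q 0) (eval-cong x (∷-cancel-≈ P≈Q))

eval-1+X^ : ∀ m x → eval (1+X^ m) x ≡ (1ℚ + x) ^ℚ m
eval-1+X^ zero    x = trans (cong (λ e → 1ℚ + e) (ℚP.*-zeroʳ x)) (ℚP.+-identityʳ 1ℚ)
eval-1+X^ (suc m) x = trans (eval-⊕ (1+X^ m) (X* (1+X^ m)) x)
  (trans (cong (λ e → e + (0ℚ + x * e)) (eval-1+X^ m x))
    (solve 2 (λ X E → E :+ (con 0ℚ :+ X :* E) := (con 1ℚ :+ X) :* E) refl x ((1ℚ + x) ^ℚ m)))

eval-recip : ∀ m P x .{{_ : NonZero (1ℚ + x)}} → DegreeBelow (suc m) P →
  eval (recip m P) x ≡ (1ℚ + x) ^ℚ m * eval P (1/ (1ℚ + x))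
eval-recip m []      x _   = sym (ℚP.*-zeroʳ ((1ℚ + x) ^ℚ m))
eval-recip m (a ∷ P) x deg = begin
  eval (a · 1+X^ m ⊕ recip (m ∸ 1) P) x
    ≡⟨ eval-⊕ (a · 1+X^ m) (recip (m ∸ 1) P) x ⟩
  eval (a · 1+X^ m) x + eval (recip (m ∸ 1) P) x
    ≡⟨ cong₂ _+_ (trans (eval-· a (1+X^ m) x) (cong (fromℤ a *_) (eval-1+X^ m x))) (tail m (degreeBelow-tail deg)) ⟩
  fromℤ a * s ^ℚ m + s ^ℚ m * (y * eval P y)
    ≡⟨ solve 4 (λ A T Y E → A :* T :+ T :* (Y :* E) := T :* (A :+ Y :* E)) refl (fromℤ a) (s ^ℚ m) y (eval P y) ⟩
  s ^ℚ m * (fromℤ a + y * eval P y) ∎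
  where
  open ≡-Reasoning
  s = 1ℚ + x
  y = 1/ s
  tail : ∀ n → DegreeBelow n P → eval (recip (n ∸ 1) P) x ≡ s ^ℚ n * (y * eval P y)
  tail zero    degP = begin
    eval (recip 0 P) x       ≡⟨ eval-zero x (recip-zero 0 (degreeBelow-zero P degP)) ⟩
    0ℚ                       ≡⟨ solve 1 (λ Y → con 0ℚ := con 1ℚ :* (Y :* con 0ℚ)) refl y ⟩
    1ℚ * (y * 0ℚ)            ≡⟨ cong (λ e → 1ℚ * (y * e)) (eval-zero y (degreeBelow-zero P degP)) ⟨
    1ℚ * (y * eval P y)      ∎
  tail (suc n) degP = begin
    eval (recip n P) x                ≡⟨ eval-recip n P x degP ⟩
    s ^ℚ n * eval P y                 ≡⟨ ℚP.*-identityˡ (s ^ℚ n * eval P y) ⟨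
    1ℚ * (s ^ℚ n * eval P y)          ≡⟨ cong (λ t → t * (s ^ℚ n * eval P y)) (ℚP.*-inverseʳ s) ⟨
    (s * y) * (s ^ℚ n * eval P y)     ≡⟨ solve 4 (λ S Y T E → (S :* Y) :* (T :* E) := (S :* T) :* (Y :* E)) refl s y (s ^ℚ n) (eval P y) ⟩
    (s * s ^ℚ n) * (y * eval P y)     ∎

proposition5p1 : (n : ℕ) → n ≥ 1 → (x : ℚ) → .{{_ : NonZero (1ℚ + x)}} →
    ((- 1ℚ) ^ℚ (n ∸ 1)) * eval (p n) x
      ≡ ((1ℚ + x) ^ℚ (n ∸ 1)) * eval (R n) (1/ (1ℚ + x))
proposition5p1 (suc m) _ x = begin
  (- 1ℚ) ^ℚ m * eval (p (suc m)) x                    ≡⟨ cong (_* eval (p (suc m)) x) (fromℤ-sign m) ⟨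
  fromℤ (sign m) * eval (p (suc m)) x                 ≡⟨ eval-· (sign m) (p (suc m)) x ⟨
  eval (sign m · p (suc m)) x                         ≡⟨ eval-cong x (sign-p≈recip-R m) ⟩
  eval (recip m (R (suc m))) x                        ≡⟨ eval-recip m (R (suc m)) x (degreeBelow-R m) ⟩
  (1ℚ + x) ^ℚ m * eval (R (suc m)) (1/ (1ℚ + x))      ∎
  where open ≡-Reasoning
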